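{- For every integer $n>2$, the algebra $\mathfrak{E}^{\{2\}}_{n+1}$ is not qualitatively representable.
   Context: Let $C=\{c_1,\dots,c_n\}$ and $C^+=\{1'\}\cup C$. The chromatic algebra $\mathfrak{E}^{\{2\}}_{n+1}$: a triple $(x,y,z)\in (C^+)^3$ is consistent if either one of $x,y,z$ equals $1'$ and the other two are equal, or $x,y,z\in C$ and $|\{x,y,z\}|=2$. The algebra has universe the power set of $C^+$, set-theoretic Boolean operations ($0=\varnothing$, $1=C^+$), identity $\{1'\}$, converse the identity map, and composition $X;Y=\{z:(x,y,z)\text{ consistent for some }x\in X,y\in Y\}$; $\leq$ is inclusion. A qualitative representation of $\mathbf A$ on a set $U$ is an injective Boolean algebra homomorphism $\varphi$ from $\mathbf A$ into the power set of $U\times U$ with $\varphi(0)=\varnothing$, $\varphi(1)=U\times U$, $\varphi(1')=\mathrm{Id}_U$, $\varphi(\breve x)=\varphi(x)^{\smile}$, and $\varphi(x)\circ\varphi(y)\subseteq\varphi(z)$ iff $x;y\leq z$ for all $x,y,z$ ($\circ$ relational composition). The algebra is qualitatively representable if it has a qualitative representation on some set. -}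

module Defs where

open import Level using (0ℓ)
open import Data.Nat using (ℕ; zero; suc)
open import Data.Bool using (Bool; true; false; _∧_; _∨_; not; if_then_else_)
open import Data.Fin using (Fin; zero; suc; _≟_)
open import Data.Fin.Subset using (Subset; _∪_; _∩_; ∁; ⊥; ⊤; _⊆_; ⁅_⁆)
open import Data.Vec using (tabulate; lookup)
open import Data.Product using (Σ; _×_; ∃-syntax)
open import Relation.Binary using (Rel)
open import Relation.Binary.PropositionalEquality using (_≡_)
open import Relation.Nullary.Decidable using (⌊_⌋)
open import Function.Bundles using (_⇔_)
import Data.Empty as E
import Data.Unit as U
open import Data.Sum using (_⊎_)

-- C⁺ = Fin (suc n); the element zero plays the role of 1', and
-- suc i (i : Fin n) plays the role of c_(i+1).

_==_ : {m : ℕ} → Fin m → Fin m → Bool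
a == b = ⌊ a ≟ b ⌋

consistent : {n : ℕ} → Fin (suc n) → Fin (suc n) → Fin (suc n) → Bool
consistent zero y z = y == z
consistent (suc x) zero z = suc x == z
consistent (suc x) (suc y) zero = x == y
consistent (suc x) (suc y) (suc z) =
  ((x == y) ∨ (y == z) ∨ (x == z)) ∧ not ((x == y) ∧ (y == z))

anyFin : {m : ℕ} → (Fin m → Bool) → Bool
anyFin {zero} f = false
anyFin {suc m} f = f zero ∨ anyFin (λ i → f (suc i))

-- The chromatic algebra E^{2}_{n+1}: universe Subset (suc n)
-- (Boolean operations ∪ ∩ ∁ ⊥ ⊤), identity ⁅ zero ⁆, converse = identity map,
-- composition:
_⨾_ : {n : ℕ} → Subset (suc n) → Subset (suc n) → Subset (suc n)
X ⨾ Y = tabulate λ z → anyFin λ x → anyFin λ y →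
  (lookup X x ∧ lookup Y y) ∧ consistent x y z

Conv : {n : ℕ} → Subset (suc n) → Subset (suc n)
Conv X = X

identity : {n : ℕ} → Subset (suc n)
identity = ⁅ zero ⁆

_≐_ : {U : Set} → Rel U 0ℓ → Rel U 0ℓ → Set
R ≐ S = ∀ a b → R a b ⇔ S a b

_∘ᴿ_ : {U : Set} → Rel U 0ℓ → Rel U 0ℓ → Rel U 0ℓ
(R ∘ᴿ S) a b = ∃[ c ] (R a c × S c b)

_⊆ᴿ_ : {U : Set} → Rel U 0ℓ → Rel U 0ℓ → Set
R ⊆ᴿ S = ∀ {a b} → R a b → S a b

record QualRep (n : ℕ) (U : Set) : Set₁ where
  field
    φ        : Subset (suc n) → Rel U 0ℓ
    injective : ∀ X Y → φ X ≐ φ Y → X ≡ Y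
    pres-∪   : ∀ X Y → φ (X ∪ Y) ≐ (λ a b → φ X a b ⊎ φ Y a b)
    pres-∩   : ∀ X Y → φ (X ∩ Y) ≐ (λ a b → φ X a b × φ Y a b)
    pres-∁   : ∀ X → φ (∁ X) ≐ (λ a b → φ X a b → E.⊥)
    pres-0   : φ ⊥ ≐ (λ _ _ → E.⊥)
    pres-1   : φ ⊤ ≐ (λ _ _ → U.⊤)
    pres-1'  : φ identity ≐ (λ a b → a ≡ b)
    pres-conv : ∀ X → φ (Conv X) ≐ (λ a b → φ X b a)
    comp     : ∀ X Y Z → ((φ X ∘ᴿ φ Y) ⊆ᴿ φ Z) ⇔ ((X ⨾ Y) ⊆ Z)

QualitativelyRepresentable : ℕ → Set₁
QualitativelyRepresentable n = Σ Set λ U → QualRep n U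

module Submission where

-- Every pair of points lies in exactly one atom, so a representation colours the complete
-- graph on U by C⁺, with 1' exactly on the diagonal and every triangle coloured as a
-- consistent triple: no triangle is rainbow or monochromatic, and every isosceles pattern
-- γγδ occurs. By Gallai's theorem on colourings without rainbow triangles, every finite
-- set of at least two points is disconnected in the graph of edges whose colour avoids
-- some two colours α and β. Take a finite set realising every isosceles pattern and a
-- third colour γ ∉ {α, β} (this needs n > 2). A point outside the component of a γγα
-- triangle sees that triangle in a single colour, which cannot be α, hence is β; dually
-- for a γγβ triangle, and these two facts contradict each other.
-- The representation only yields the isosceles triangles doubly negated, so the argument
-- runs under a double negation, where excluded middle is available.

open import Defs
open import Level using (0ℓ)
open import Data.Nat using (ℕ; zero; suc; _<_; s≤s)
open import Data.Fin using (Fin; zero; suc; _≟_)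
open import Data.Bool using (Bool; true; false; _∧_; _∨_)
open import Data.Bool.Properties using (∨-zeroʳ; ∧-conicalˡ; ∧-conicalʳ)
open import Data.Empty using (⊥; ⊥-elim)
open import Data.Product using (∃; ∃₂; _×_; _,_; proj₁; proj₂)
open import Data.Sum using (_⊎_; inj₁; inj₂)
open import Data.Unit using (tt)
open import Data.List using (List; []; _∷_; _++_; map; allFin)
open import Data.List.Membership.Propositional using (_∈_; _∉_)
open import Data.List.Membership.Propositional.Properties using (∈-allFin)
open import Data.List.Relation.Binary.Subset.Propositional using () renaming (_⊆_ to _⊆ₗ_)
open import Data.List.Relation.Binary.Subset.Propositional.Properties
  using (⊆-refl; ∈-∷⁺ʳ; xs⊆xs++ys; xs⊆ys++xs)
open import Data.List.Relation.Unary.Any using (Any; here; there; satisfied)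
import Data.List.Relation.Unary.Any as Any
import Data.List.Relation.Unary.Any.Properties as Any
open import Data.Fin.Subset using (Subset; ⁅_⁆; _∩_; ⋃; ∁; Empty)
  renaming (_∈_ to _∈ₛ_; _∉_ to _∉ₛ_; ⊥ to ∅; ⊤ to full)
open import Data.Fin.Subset.Properties
  using (_∈?_; x∈⁅x⁆; x∈⁅y⁆⇒x≡y; x∈p∩q⁻; p⊆p∪q; q⊆p∪q; x∈p⇒x∉∁p; ⊆-antisym; ⊆⊤; Empty-unique)
open import Data.Vec using (lookup)
open import Data.Vec.Properties using (lookup∘tabulate; []=⇒lookup; lookup⇒[]=)
open import Function using (_∘_)
open import Function.Bundles using (Equivalence)
open Equivalence using (to; from)
open import Relation.Binary using (Rel)
open import Relation.Binary.Construct.Closure.ReflexiveTransitive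
  using (Star; ε; _◅_; _◅◅_; reverse)
import Relation.Binary.Construct.Closure.ReflexiveTransitive as Star
open import Relation.Binary.PropositionalEquality
  using (_≡_; _≢_; refl; sym; trans; cong; cong₂; subst; subst₂; ≢-sym; module ≡-Reasoning)
open import Relation.Nullary using (¬_; Dec; yes; no; ¬?)
open import Relation.Nullary.Decidable using (_×-dec_; decidable-stable; ¬¬-excluded-middle)

private
  variable
    k : ℕ

consistent-≢⇒≡ : {x y w : Fin (suc k)} → consistent x y w ≡ true → y ≢ x → y ≢ w → x ≡ w
consistent-≢⇒≡ {x = zero} {y} {w} c y≢x y≢w with y ≟ w
... | yes y≡w = ⊥-elim (y≢w y≡w)
consistent-≢⇒≡ {x = zero} () _ _ | no _
consistent-≢⇒≡ {x = suc x} {zero} {w} c y≢x y≢w with suc x ≟ w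
... | yes x≡w = x≡w
consistent-≢⇒≡ {x = suc x} {zero} () _ _ | no _
consistent-≢⇒≡ {x = suc x} {suc y} {zero} c y≢x y≢w with x ≟ y
... | yes x≡y = ⊥-elim (y≢x (cong suc (sym x≡y)))
consistent-≢⇒≡ {x = suc x} {suc y} {zero} () _ _ | no _
consistent-≢⇒≡ {x = suc x} {suc y} {suc w} c y≢x y≢w with x ≟ y | y ≟ w | x ≟ w
... | yes x≡y | _ | _ = ⊥-elim (y≢x (cong suc (sym x≡y)))
... | no _ | yes y≡w | _ = ⊥-elim (y≢w (cong suc y≡w))
... | no _ | no _ | yes x≡w = cong suc x≡w
consistent-≢⇒≡ {x = suc x} {suc y} {suc w} () _ _ | no _ | no _ | no _

¬consistent-monochromatic : {x : Fin (suc k)} → x ≢ zero → consistent x x x ≢ true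
¬consistent-monochromatic {x = zero} x≢0 _ = x≢0 refl
¬consistent-monochromatic {x = suc x} _ c with x ≟ x
¬consistent-monochromatic {x = suc x} _ () | yes _
... | no x≢x = x≢x refl

consistent-isosceles : {x y : Fin k} → x ≢ y → consistent (suc x) (suc x) (suc y) ≡ true
consistent-isosceles {x = x} {y} x≢y with x ≟ x | x ≟ y
... | _ | yes x≡y = ⊥-elim (x≢y x≡y)
... | yes _ | no _ = refl
... | no x≢x | no _ = ⊥-elim (x≢x refl)

NonDegenerate : Fin (suc k) → Fin (suc k) → Set
NonDegenerate γ δ = γ ≢ zero × δ ≢ zero × γ ≢ δ

nonDegenerate? : (γ δ : Fin (suc k)) → Dec (NonDegenerate γ δ)
nonDegenerate? γ δ = ¬? (γ ≟ zero) ×-dec ¬? (δ ≟ zero) ×-dec ¬? (γ ≟ δ)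

record Colouring (k : ℕ) (U : Set) : Set where
  field
    col            : U → U → Fin (suc k)
    col≡zero⇒≡     : ∀ {a b} → col a b ≡ zero → a ≡ b
    col-refl       : ∀ a → col a a ≡ zero
    col-sym        : ∀ a b → col a b ≡ col b a
    col-consistent : ∀ a b c → consistent (col a c) (col c b) (col a b) ≡ true

  legs-agree : ∀ {a b z} → col a b ≢ col z a → col a b ≢ col z b → col z a ≡ col z b
  legs-agree {a} {b} {z} = consistent-≢⇒≡ (col-consistent z b a)

  ¬monochromatic : ∀ {a b c γ} → γ ≢ zero → col a b ≡ γ → col b c ≡ γ → col a c ≡ γ → ⊥
  ¬monochromatic {a} {b} {c} γ≢0 refl bc ac =
    ¬consistent-monochromatic γ≢0
      (subst₂ (λ p q → consistent (col a b) p q ≡ true) bc ac (col-consistent a c b))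

module Gallai {U : Set} (χ : Colouring k U) where
  open Colouring χ

  Colour : Set
  Colour = Fin (suc k)

  Avoids : Colour → Colour → Colour → Set
  Avoids α β γ = γ ≢ zero × γ ≢ α × γ ≢ β

  avoids? : ∀ α β γ → Dec (Avoids α β γ)
  avoids? α β γ = ¬? (γ ≟ zero) ×-dec ¬? (γ ≟ α) ×-dec ¬? (γ ≟ β)

  ¬Avoids⇒≡ : ∀ {α β γ} → γ ≢ zero → ¬ Avoids α β γ → γ ≡ α ⊎ γ ≡ β
  ¬Avoids⇒≡ {α} {β} {γ} γ≢0 ¬av with γ ≟ α | γ ≟ β
  ... | yes γ≡α | _ = inj₁ γ≡α
  ... | no _ | yes γ≡β = inj₂ γ≡β
  ... | no γ≢α | no γ≢β = ⊥-elim (¬av (γ≢0 , γ≢α , γ≢β))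

  ≢-if-Avoids : ∀ {α β γ δ} → Avoids α β γ → ¬ Avoids α β δ → γ ≢ δ
  ≢-if-Avoids av ¬av refl = ¬av av

  Edge : Colour → Colour → Rel U 0ℓ
  Edge α β a b = Avoids α β (col a b)

  module _ {α β : Colour} where

    Edge-sym : ∀ {a b} → Edge α β a b → Edge α β b a
    Edge-sym {a} {b} = subst (Avoids α β) (col-sym a b)

    Edge-irrefl : ∀ {a} → ¬ Edge α β a a
    Edge-irrefl {a} (c≢0 , _) = c≢0 (col-refl a)

    Step : List U → Rel U 0ℓ
    Step L a b = a ∈ L × b ∈ L × Edge α β a b

  Path : List U → Colour → Colour → Rel U 0ℓ
  Path L α β = Star (Step {α} {β} L)

  module _ {L : List U} {α β : Colour} where

    Path-sym : ∀ {a b} → Path L α β a b → Path L α β b a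
    Path-sym = reverse λ (a∈ , b∈ , e) → b∈ , a∈ , Edge-sym e

    Path-target∈ : ∀ {a b} → a ∈ L → Path L α β a b → b ∈ L
    Path-target∈ a∈ ε = a∈
    Path-target∈ _ ((_ , b∈ , _) ◅ p) = Path-target∈ b∈ p

    Path-source∈ : ∀ {a b} → b ∈ L → Path L α β a b → a ∈ L
    Path-source∈ b∈ p = Path-target∈ b∈ (Path-sym p)

    Path-mono : ∀ {M a b} → L ⊆ₗ M → Path L α β a b → Path M α β a b
    Path-mono L⊆M = Star.map λ (a∈ , b∈ , e) → L⊆M a∈ , L⊆M b∈ , e

    ¬Path⇒¬Edge : ∀ {a b} → a ∈ L → b ∈ L → ¬ Path L α β a b → ¬ Edge α β a b
    ¬Path⇒¬Edge a∈ b∈ ¬p e = ¬p ((a∈ , b∈ , e) ◅ ε)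

    Path-from-isolated : ∀ {a b} → (∀ t → t ∈ L → ¬ Edge α β a t) → Path L α β a b → a ≡ b
    Path-from-isolated _ ε = refl
    Path-from-isolated iso ((_ , t∈ , e) ◅ _) = ⊥-elim (iso _ t∈ e)

    col-constant-along : ∀ {z a w} → (∀ t → Path L α β a t → ¬ Edge α β z t) →
                         Path L α β a w → col z a ≡ col z w
    col-constant-along _ ε = refl
    col-constant-along ¬e (s@(_ , _ , e) ◅ p) =
      trans (legs-agree (≢-if-Avoids e (¬e _ ε)) (≢-if-Avoids e (¬e _ (s ◅ ε))))
            (col-constant-along (λ t q → ¬e t (s ◅ q)) p)

    col-constant-on-component : ∀ {z a w} → z ∈ L → a ∈ L → ¬ Path L α β z a →
                                Path L α β a w → col z a ≡ col z w
    col-constant-on-component z∈ a∈ ¬z⇝a = col-constant-along λ t a⇝t e →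
      ¬z⇝a ((z∈ , Path-target∈ a∈ a⇝t , e) ◅ Path-sym a⇝t)

    unlinked-col : ∀ {z a} → z ∈ L → a ∈ L → ¬ Path L α β z a → col z a ≡ α ⊎ col z a ≡ β
    unlinked-col {z} z∈ a∈ ¬z⇝a =
      ¬Avoids⇒≡ (λ c≡0 → ¬z⇝a (subst (Path L α β z) (col≡zero⇒≡ c≡0) ε)) (¬Path⇒¬Edge z∈ a∈ ¬z⇝a)

  HasDistinct : List U → Set
  HasDistinct L = ∃₂ λ x y → x ∈ L × y ∈ L × x ≢ y

  record Disconnection (L : List U) : Set where
    constructor disconnection
    field
      α β  : Colour
      α≢0  : α ≢ zero
      β≢0  : β ≢ zero
      x y  : U
      x∈L  : x ∈ L
      y∈L  : y ∈ L
      ¬x⇝y : ¬ Path L α β x y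

  other-point : ∀ {v L} → HasDistinct (v ∷ L) → ¬ HasDistinct L → ∃ λ w → w ∈ L × w ≢ v
  other-point (_ , _ , here refl , here refl , x≢y) _ = ⊥-elim (x≢y refl)
  other-point (_ , y , here refl , there y∈ , x≢y) _ = y , y∈ , λ y≡x → x≢y (sym y≡x)
  other-point (x , _ , there x∈ , here refl , x≢y) _ = x , x∈ , x≢y
  other-point (x , y , there x∈ , there y∈ , x≢y) ¬d = ⊥-elim (¬d (x , y , x∈ , y∈ , x≢y))

  disconnection-∷-constant : ∀ {v L} → HasDistinct (v ∷ L) → ¬ HasDistinct L →
                               Disconnection (v ∷ L)
  disconnection-∷-constant {v} {L} d ¬d with other-point d ¬d
  ... | w , w∈ , w≢v =
    disconnection (col v w) (col v w) vw≢0 vw≢0 v w (here refl) (there w∈)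
      λ v⇝w → w≢v (sym (Path-from-isolated isolated v⇝w))
    where
      vw≢0 : col v w ≢ zero
      vw≢0 vw≡0 = w≢v (sym (col≡zero⇒≡ vw≡0))
      isolated : ∀ t → t ∈ v ∷ L → ¬ Edge (col v w) (col v w) v t
      isolated _ (here refl) = Edge-irrefl
      isolated t (there t∈) (_ , vt≢vw , _) =
        ¬d (t , w , t∈ , w∈ , λ t≡w → vt≢vw (cong (col v) t≡w))

  -- If v ∉ L reaches all of L while L itself is disconnected, then v sees its edge-neighbours
  -- in one colour and all other points of L in one colour, so v is isolated for these two.
  module Reaching (v : U) (L : List U) (v∉L : v ∉ L) (α β : Colour)
                   (reach : ∀ z → z ∈ L → ¬ ¬ Path (v ∷ L) α β v z) where

    Path-split : ∀ {a x} → x ∈ L → Path (v ∷ L) α β a x →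
                 Path L α β a x ⊎ ∃ λ u → u ∈ L × Edge α β v u × Path L α β u x
    Path-split x∈ ε = inj₁ ε
    Path-split x∈ ((a∈ , _ , e) ◅ p) with Path-split x∈ p | a∈
    ... | inj₂ r | _ = inj₂ r
    ... | inj₁ q | here refl = inj₂ (_ , Path-source∈ x∈ q , e , q)
    ... | inj₁ q | there a∈L = inj₁ ((a∈L , Path-source∈ x∈ q , e) ◅ q)

    first-edge : ∀ {x} → x ∈ L → Path (v ∷ L) α β v x →
                 ∃ λ u → u ∈ L × Edge α β v u × Path L α β u x
    first-edge x∈ p with Path-split x∈ p
    ... | inj₁ q = ⊥-elim (v∉L (Path-source∈ x∈ q))
    ... | inj₂ r = r

    unlinked-from-v : ∀ {γ δ x} → x ∈ L → (∀ t → t ∈ L → ¬ Edge γ δ v t) → ¬ Path (v ∷ L) γ δ v x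
    unlinked-from-v {γ} {δ} x∈ iso p = v∉L (subst (_∈ L) (sym (Path-from-isolated iso⁺ p)) x∈)
      where
        iso⁺ : ∀ t → t ∈ v ∷ L → ¬ Edge γ δ v t
        iso⁺ _ (here refl) = Edge-irrefl
        iso⁺ t (there t∈) = iso t t∈

    col-v≢0 : ∀ {w} → w ∈ L → col v w ≢ zero
    col-v≢0 w∈ vw≡0 = v∉L (subst (_∈ L) (sym (col≡zero⇒≡ vw≡0)) w∈)

    edge-neighbours-agree : ∀ {w o} → w ∈ L → o ∈ L → Edge α β v w → Edge α β v o →
                            ¬ Path L α β w o → col v w ≡ col v o
    edge-neighbours-agree w∈ o∈ ew eo ¬w⇝o =
      legs-agree (≢-sym (≢-if-Avoids ew ¬wo)) (≢-sym (≢-if-Avoids eo ¬wo))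
      where ¬wo = ¬Path⇒¬Edge w∈ o∈ ¬w⇝o

    foreign-neighbour-agrees : ∀ {w o} → w ∈ L → o ∈ L → ¬ Edge α β v w → Edge α β v o →
                               ¬ Path L α β w o → col v w ≡ col w o
    foreign-neighbour-agrees {w} {o} w∈ o∈ ¬vw eo ¬w⇝o =
      trans (col-sym v w)
        (legs-agree (≢-if-Avoids eo (¬vw ∘ Edge-sym)) (≢-if-Avoids eo (¬Path⇒¬Edge w∈ o∈ ¬w⇝o)))

    non-edges-agree-via : ∀ {w₁ w₂ o} → w₁ ∈ L → w₂ ∈ L → o ∈ L →
                          ¬ Edge α β v w₁ → ¬ Edge α β v w₂ → Edge α β v o →
                          Path L α β w₁ w₂ → ¬ Path L α β w₁ o → col v w₁ ≡ col v w₂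
    non-edges-agree-via {w₁} {w₂} {o} w₁∈ w₂∈ o∈ ¬vw₁ ¬vw₂ eo w₁⇝w₂ ¬w₁⇝o = begin
      col v w₁ ≡⟨ foreign-neighbour-agrees w₁∈ o∈ ¬vw₁ eo ¬w₁⇝o ⟩
      col w₁ o ≡⟨ col-sym w₁ o ⟩
      col o w₁ ≡⟨ col-constant-on-component o∈ w₁∈ (¬w₁⇝o ∘ Path-sym) w₁⇝w₂ ⟩
      col o w₂ ≡⟨ col-sym o w₂ ⟩
      col w₂ o ≡⟨ foreign-neighbour-agrees w₂∈ o∈ ¬vw₂ eo (¬w₁⇝o ∘ (w₁⇝w₂ ◅◅_)) ⟨
      col v w₂ ∎
      where open ≡-Reasoning

    col-across-components : ∀ {w₁ w₂} → w₁ ∈ L → w₂ ∈ L → ¬ Edge α β v w₂ →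
                            ¬ Path L α β w₁ w₂ → col v w₂ ≡ col w₂ w₁
    col-across-components {w₁} {w₂} w₁∈ w₂∈ ¬vw₂ ¬w₁⇝w₂ =
      decidable-stable (col v w₂ ≟ col w₂ w₁) λ ≢ → reach w₁ w₁∈ λ v⇝w₁ →
        let u , u∈ , eu , u⇝w₁ = first-edge w₁∈ v⇝w₁
            ¬w₂⇝u = λ w₂⇝u → ¬w₁⇝w₂ (Path-sym (w₂⇝u ◅◅ u⇝w₁))
        in ≢ (trans (foreign-neighbour-agrees w₂∈ u∈ ¬vw₂ eu ¬w₂⇝u)
                    (col-constant-on-component w₂∈ u∈ ¬w₂⇝u u⇝w₁))

    module _ {u u′} (u∈ : u ∈ L) (u′∈ : u′ ∈ L) (eu : Edge α β v u) (eu′ : Edge α β v u′)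
             (¬u⇝u′ : ¬ Path L α β u u′) where

      edge-col : ∀ {w} → w ∈ L → Edge α β v w → col v w ≡ col v u
      edge-col {w} w∈ ew = decidable-stable (col v w ≟ col v u) λ ≢ → ¬¬-excluded-middle λ where
        (yes w⇝u′) → ≢ (edge-neighbours-agree w∈ u∈ ew eu λ w⇝u → ¬u⇝u′ (Path-sym w⇝u ◅◅ w⇝u′))
        (no ¬w⇝u′) → ≢ (trans (edge-neighbours-agree w∈ u′∈ ew eu′ ¬w⇝u′)
                               (sym (edge-neighbours-agree u∈ u′∈ eu eu′ ¬u⇝u′)))

      non-edge-col : ∀ {w₁ w₂} → w₁ ∈ L → w₂ ∈ L → ¬ Edge α β v w₁ → ¬ Edge α β v w₂ →
                     col v w₁ ≡ col v w₂
      non-edge-col {w₁} {w₂} w₁∈ w₂∈ ¬vw₁ ¬vw₂ =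
        decidable-stable (col v w₁ ≟ col v w₂) λ ≢ → ¬¬-excluded-middle λ where
          (no ¬w₁⇝w₂) → ≢ (begin
            col v w₁  ≡⟨ col-across-components w₂∈ w₁∈ ¬vw₁ (¬w₁⇝w₂ ∘ Path-sym) ⟩
            col w₁ w₂ ≡⟨ col-sym w₁ w₂ ⟩
            col w₂ w₁ ≡⟨ col-across-components w₁∈ w₂∈ ¬vw₂ ¬w₁⇝w₂ ⟨
            col v w₂  ∎)
          (yes w₁⇝w₂) → ¬¬-excluded-middle λ where
            (yes w₁⇝u) → ≢ (non-edges-agree-via w₁∈ w₂∈ u′∈ ¬vw₁ ¬vw₂ eu′ w₁⇝w₂
                              λ w₁⇝u′ → ¬u⇝u′ (Path-sym w₁⇝u ◅◅ w₁⇝u′))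
            (no ¬w₁⇝u) → ≢ (non-edges-agree-via w₁∈ w₂∈ u∈ ¬vw₁ ¬vw₂ eu w₁⇝w₂ ¬w₁⇝u)
        where open ≡-Reasoning

      v-isolated : ∀ {δ} → (∀ {t} → t ∈ L → ¬ Edge α β v t → col v t ≡ δ) →
                   ∀ t → t ∈ L → ¬ Edge (col v u) δ v t
      v-isolated non-edge t t∈ (_ , ≢γ , ≢δ) with avoids? α β (col v t)
      ... | yes et = ≢γ (edge-col t∈ et)
      ... | no ¬et = ≢δ (non-edge t∈ ¬et)

      disconnection-at-v : ∀ {x δ} → x ∈ L → δ ≢ zero →
                           (∀ {t} → t ∈ L → ¬ Edge α β v t → col v t ≡ δ) → Disconnection (v ∷ L)
      disconnection-at-v {x} {δ} x∈ δ≢0 non-edge =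
        disconnection (col v u) δ (col-v≢0 u∈) δ≢0 v x (here refl) (there x∈)
          (unlinked-from-v x∈ (v-isolated non-edge))

      disconnection-through-v : ∀ {x} → x ∈ L → ¬ ¬ Disconnection (v ∷ L)
      disconnection-through-v x∈ κ = ¬¬-excluded-middle {A = ∃ λ w → w ∈ L × ¬ Edge α β v w} λ where
        (yes (w₀ , w₀∈ , ¬vw₀)) →
          κ (disconnection-at-v x∈ (col-v≢0 w₀∈) λ t∈ ¬vt → non-edge-col t∈ w₀∈ ¬vt ¬vw₀)
        (no none) →
          κ (disconnection-at-v x∈ (col-v≢0 u∈) λ t∈ ¬vt → ⊥-elim (none (_ , t∈ , ¬vt)))

    disconnection-∷ : ∀ {x y} → x ∈ L → y ∈ L → ¬ Path L α β x y → ¬ ¬ Disconnection (v ∷ L)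
    disconnection-∷ x∈ y∈ ¬x⇝y κ = reach _ x∈ λ v⇝x → reach _ y∈ λ v⇝y →
      let u , u∈ , eu , u⇝x = first-edge x∈ v⇝x
          u′ , u′∈ , eu′ , u′⇝y = first-edge y∈ v⇝y
      in disconnection-through-v u∈ u′∈ eu eu′ (λ u⇝u′ → ¬x⇝y (Path-sym u⇝x ◅◅ u⇝u′ ◅◅ u′⇝y)) x∈ κ

  disconnection-∷ : ∀ {v L} → Disconnection L → ¬ ¬ Disconnection (v ∷ L)
  disconnection-∷ {v} {L} (disconnection α β α≢0 β≢0 x y x∈ y∈ ¬x⇝y) κ = ¬¬-excluded-middle λ where
    (yes v∈L) → κ (disconnection α β α≢0 β≢0 x y (there x∈) (there y∈)
                    (¬x⇝y ∘ Path-mono (∈-∷⁺ʳ v∈L ⊆-refl)))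
    (no v∉L) → ¬¬-excluded-middle {A = ∃ λ z → z ∈ L × ¬ Path (v ∷ L) α β v z} λ where
      (yes (z , z∈ , ¬v⇝z)) → κ (disconnection α β α≢0 β≢0 v z (here refl) (there z∈) ¬v⇝z)
      (no reach) → Reaching.disconnection-∷ v L v∉L α β (λ z z∈ ¬v⇝z → reach (z , z∈ , ¬v⇝z))
                     x∈ y∈ ¬x⇝y κ

  gallai : ∀ L → HasDistinct L → ¬ ¬ Disconnection L
  gallai [] (_ , _ , () , _)
  gallai (v ∷ L) d κ = ¬¬-excluded-middle λ where
    (yes d′) → gallai L d′ λ D → disconnection-∷ D κ
    (no ¬d′) → κ (disconnection-∷-constant d ¬d′)

  record Isosceles (L : List U) (γ δ : Colour) : Set where
    constructor isosceles
    field
      a b c : U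
      a∈L   : a ∈ L
      b∈L   : b ∈ L
      c∈L   : c ∈ L
      ab≡γ  : col a b ≡ γ
      bc≡γ  : col b c ≡ γ
      ac≡δ  : col a c ≡ δ

  Isosceles-mono : ∀ {L M γ δ} → L ⊆ₗ M → Isosceles L γ δ → Isosceles M γ δ
  Isosceles-mono L⊆M (isosceles a b c a∈ b∈ c∈ ab bc ac) =
    isosceles a b c (L⊆M a∈) (L⊆M b∈) (L⊆M c∈) ab bc ac

  Isosceles⇒HasDistinct : ∀ {L γ δ} → δ ≢ zero → Isosceles L γ δ → HasDistinct L
  Isosceles⇒HasDistinct δ≢0 (isosceles a _ c a∈ _ c∈ _ _ ac) =
    a , c , a∈ , c∈ , λ { refl → δ≢0 (trans (sym ac) (col-refl a)) }

  IsoscelesComplete : List U → Set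
  IsoscelesComplete L = ∀ γ δ → NonDegenerate γ δ → Isosceles L γ δ

  unlinked-from-isosceles : ∀ {L α β γ δ z} → Avoids α β γ → δ ≢ zero → (T : Isosceles L γ δ) →
                            z ∈ L → ¬ Path L α β z (Isosceles.a T) → col z (Isosceles.a T) ≢ δ
  unlinked-from-isosceles {L} {α} {β} {δ = δ} {z}
                          γ-avoids δ≢0 (isosceles a b c a∈ b∈ c∈ ab bc ac) z∈ ¬z⇝a za≡δ =
    ¬monochromatic δ≢0 ac (trans (col-sym c z) zc≡δ) (trans (col-sym a z) za≡δ)
    where
      a⇝c : Path L α β a c
      a⇝c = (a∈ , b∈ , subst (Avoids α β) (sym ab) γ-avoids)
          ◅ (b∈ , c∈ , subst (Avoids α β) (sym bc) γ-avoids) ◅ ε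
      zc≡δ : col z c ≡ δ
      zc≡δ = trans (sym (col-constant-on-component z∈ a∈ ¬z⇝a a⇝c)) za≡δ

  IsoscelesComplete⇒¬Disconnection : ∀ {L} → IsoscelesComplete L → (∀ α β → ∃ (Avoids α β)) →
                                      ¬ Disconnection L
  IsoscelesComplete⇒¬Disconnection {L} isosceles-in third
                                    (disconnection α β α≢0 β≢0 x y x∈ y∈ ¬x⇝y) =
    some-point-unlinked-from-a λ (z , z∈ , ¬z⇝a) →
      ¬¬-excluded-middle {A = Path L α β p a} λ where
        (no ¬p⇝a) → a-side p∈ ¬p⇝a (trans (col-sym p a) (p-side a∈ (¬p⇝a ∘ Path-sym)))
        (yes p⇝a) → let ¬z⇝p = λ z⇝p → ¬z⇝a (z⇝p ◅◅ p⇝a) in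
          a-side z∈ ¬z⇝a (trans (sym (col-constant-on-component z∈ p∈ ¬z⇝p p⇝a)) (p-side z∈ ¬z⇝p))
    where
      γ = proj₁ (third α β)
      γ-avoids = proj₂ (third α β)
      Tα = isosceles-in γ α (proj₁ γ-avoids , α≢0 , proj₁ (proj₂ γ-avoids))
      Tβ = isosceles-in γ β (proj₁ γ-avoids , β≢0 , proj₂ (proj₂ γ-avoids))
      open Isosceles Tα using (a) renaming (a∈L to a∈)
      open Isosceles Tβ using () renaming (a to p; a∈L to p∈)

      a-side : ∀ {z} → z ∈ L → ¬ Path L α β z a → col z a ≢ α
      a-side = unlinked-from-isosceles γ-avoids α≢0 Tα

      p-side : ∀ {z} → z ∈ L → ¬ Path L α β z p → col z p ≡ α
      p-side z∈ ¬z⇝p with unlinked-col z∈ p∈ ¬z⇝p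
      ... | inj₁ zp≡α = zp≡α
      ... | inj₂ zp≡β = ⊥-elim (unlinked-from-isosceles γ-avoids β≢0 Tβ z∈ ¬z⇝p zp≡β)

      some-point-unlinked-from-a : ¬ ¬ (∃ λ z → z ∈ L × ¬ Path L α β z a)
      some-point-unlinked-from-a κ = ¬¬-excluded-middle {A = Path L α β x a} λ where
        (yes x⇝a) → κ (y , y∈ , λ y⇝a → ¬x⇝y (x⇝a ◅◅ Path-sym y⇝a))
        (no ¬x⇝a) → κ (x , x∈ , ¬x⇝a)

anyFin-true⁻ : ∀ {m} (f : Fin m → Bool) → anyFin f ≡ true → ∃ λ i → f i ≡ true
anyFin-true⁻ {suc m} f h with f zero in eq
... | true = zero , eq
... | false with anyFin-true⁻ (λ i → f (suc i)) h
...   | i , fi≡true = suc i , fi≡true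

anyFin-true⁺ : ∀ {m} (f : Fin m → Bool) i → f i ≡ true → anyFin f ≡ true
anyFin-true⁺ f zero fi≡true = cong (_∨ anyFin (λ j → f (suc j))) fi≡true
anyFin-true⁺ f (suc i) fi≡true =
  trans (cong (f zero ∨_) (anyFin-true⁺ (λ j → f (suc j)) i fi≡true)) (∨-zeroʳ (f zero))

lookup-⁅⁆ : ∀ {m} (x y : Fin m) → lookup ⁅ x ⁆ y ≡ true → y ≡ x
lookup-⁅⁆ x y l = x∈⁅y⁆⇒x≡y x (lookup⇒[]= y ⁅ x ⁆ l)

lookup-⁅⁆-self : ∀ {m} (x : Fin m) → lookup ⁅ x ⁆ x ≡ true
lookup-⁅⁆-self x = []=⇒lookup (x∈⁅x⁆ x)

-- The body of _⨾_, named so that lookup∘tabulate and anyFin-true⁺ can be given it explicitly.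
⨾-witness : Subset (suc k) → Subset (suc k) → Fin (suc k) → Fin (suc k) → Fin (suc k) → Bool
⨾-witness X Y z x y = (lookup X x ∧ lookup Y y) ∧ consistent x y z

⨾-entry : Subset (suc k) → Subset (suc k) → Fin (suc k) → Bool
⨾-entry X Y z = anyFin λ x → anyFin (⨾-witness X Y z x)

∈-⁅⁆⨾⁅⁆⁻ : {x y z : Fin (suc k)} → z ∈ₛ ⁅ x ⁆ ⨾ ⁅ y ⁆ → consistent x y z ≡ true
∈-⁅⁆⨾⁅⁆⁻ {x = x} {y} {z} z∈
  with anyFin-true⁻ _ (trans (sym (lookup∘tabulate (⨾-entry ⁅ x ⁆ ⁅ y ⁆) z)) ([]=⇒lookup z∈))
... | x′ , h with anyFin-true⁻ _ h
...   | y′ , h′ = subst₂ (λ p q → consistent p q z ≡ true)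
                    (lookup-⁅⁆ x x′ (∧-conicalˡ _ _ picks)) (lookup-⁅⁆ y y′ (∧-conicalʳ _ _ picks))
                    (∧-conicalʳ _ _ h′)
  where picks = ∧-conicalˡ _ _ h′

∈-⁅⁆⨾⁅⁆⁺ : {x y z : Fin (suc k)} → consistent x y z ≡ true → z ∈ₛ ⁅ x ⁆ ⨾ ⁅ y ⁆
∈-⁅⁆⨾⁅⁆⁺ {x = x} {y} {z} c = lookup⇒[]= z _
  (trans (lookup∘tabulate (⨾-entry ⁅ x ⁆ ⁅ y ⁆) z)
    (anyFin-true⁺ (λ x′ → anyFin (⨾-witness ⁅ x ⁆ ⁅ y ⁆ z x′)) x
      (anyFin-true⁺ (⨾-witness ⁅ x ⁆ ⁅ y ⁆ z x) y picks)))
  where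
    picks : (lookup ⁅ x ⁆ x ∧ lookup ⁅ y ⁆ y) ∧ consistent x y z ≡ true
    picks = trans (cong₂ (λ p q → (p ∧ q) ∧ consistent x y z) (lookup-⁅⁆-self x) (lookup-⁅⁆-self y))
                  c

∈-⋃⁺ : ∀ {m} {x : Fin m} {Xs : List (Subset m)} → Any (x ∈ₛ_) Xs → x ∈ₛ ⋃ Xs
∈-⋃⁺ (here x∈X) = p⊆p∪q _ x∈X
∈-⋃⁺ {Xs = X ∷ Xs} (there x∈Xs) = q⊆p∪q X (⋃ Xs) (∈-⋃⁺ x∈Xs)

full≡⋃-singletons : ∀ {m} → full ≡ ⋃ (map ⁅_⁆ (allFin m))
full≡⋃-singletons =
  ⊆-antisym (λ {x} _ → ∈-⋃⁺ (Any.map⁺ (Any.map (λ { refl → x∈⁅x⁆ x }) (∈-allFin x)))) ⊆⊤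

module Representation {n : ℕ} {U : Set} (R : QualRep n U) where
  open QualRep R

  Atom : Fin (suc n) → Rel U 0ℓ
  Atom i = φ ⁅ i ⁆

  φ∅-empty : ∀ {a b} → ¬ φ ∅ a b
  φ∅-empty {a} {b} = to (pres-0 a b)

  φ-disjoint : ∀ {X Y a b} → Empty (X ∩ Y) → φ X a b → φ Y a b → ⊥
  φ-disjoint {X} {Y} {a} {b} X∩Y-empty p q =
    φ∅-empty (subst (λ Z → φ Z a b) (Empty-unique X∩Y-empty) (from (pres-∩ X Y a b) (p , q)))

  φ-⋃⁻ : ∀ Xs {a b} → φ (⋃ Xs) a b → Any (λ X → φ X a b) Xs
  φ-⋃⁻ [] p = ⊥-elim (φ∅-empty p)
  φ-⋃⁻ (X ∷ Xs) {a} {b} p with to (pres-∪ X (⋃ Xs) a b) p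
  ... | inj₁ q = here q
  ... | inj₂ q = there (φ-⋃⁻ Xs q)

  φ-⨾ : ∀ {X Y a b c} → φ X a c → φ Y c b → φ (X ⨾ Y) a b
  φ-⨾ {X} {Y} p q = from (comp X Y (X ⨾ Y)) (λ z∈ → z∈) (_ , p , q)

  Atom⇒∈ : ∀ {X z a b} → Atom z a b → φ X a b → z ∈ₛ X
  Atom⇒∈ {X} {z} r p = decidable-stable (z ∈? X) λ z∉X → φ-disjoint (disjoint z∉X) r p
    where
      disjoint : z ∉ₛ X → Empty (⁅ z ⁆ ∩ X)
      disjoint z∉X (t , t∈) = let t∈⁅z⁆ , t∈X = x∈p∩q⁻ ⁅ z ⁆ X t∈ in
        z∉X (subst (_∈ₛ X) (x∈⁅y⁆⇒x≡y z t∈⁅z⁆) t∈X)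

  atom-of : ∀ a b → ∃ λ i → Atom i a b
  atom-of a b = satisfied atom
    where
      atom : Any (λ i → Atom i a b) (allFin (suc n))
      atom = Any.map⁻ (φ-⋃⁻ _ (subst (λ X → φ X a b) full≡⋃-singletons (from (pres-1 a b) tt)))

  atom-unique : ∀ {i j a b} → Atom i a b → Atom j a b → i ≡ j
  atom-unique {i} p q = sym (x∈⁅y⁆⇒x≡y i (Atom⇒∈ q p))

  atoms-consistent : ∀ {x y z a b c} → Atom x a c → Atom y c b → Atom z a b →
                     consistent x y z ≡ true
  atoms-consistent {x} {y} p q r = ∈-⁅⁆⨾⁅⁆⁻ {x = x} {y} (Atom⇒∈ r (φ-⨾ p q))

  atoms-realised : ∀ {x y z} → consistent x y z ≡ true →
                   ¬ ¬ (∃ λ a → ∃ λ b → ∃ λ c → Atom x a c × Atom y c b × Atom z a b)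
  atoms-realised {x} {y} {z} xyz ¬realised =
    x∈p⇒x∉∁p (x∈⁅x⁆ z) (to (comp ⁅ x ⁆ ⁅ y ⁆ (∁ ⁅ z ⁆)) avoids-z (∈-⁅⁆⨾⁅⁆⁺ {x = x} {y} xyz))
    where
      avoids-z : (φ ⁅ x ⁆ ∘ᴿ φ ⁅ y ⁆) ⊆ᴿ φ (∁ ⁅ z ⁆)
      avoids-z {a} {b} (c , p , q) = from (pres-∁ ⁅ z ⁆ a b) λ r → ¬realised (a , b , c , p , q , r)

  col : U → U → Fin (suc n)
  col a b = proj₁ (atom-of a b)

  col-atom : ∀ a b → Atom (col a b) a b
  col-atom a b = proj₂ (atom-of a b)

  col-unique : ∀ {i a b} → Atom i a b → col a b ≡ i
  col-unique = atom-unique (col-atom _ _)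

  colouring : Colouring n U
  colouring = record
    { col            = col
    ; col≡zero⇒≡     = λ {a} {b} ab≡0 →
                         to (pres-1' a b) (subst (λ i → Atom i a b) ab≡0 (col-atom a b))
    ; col-refl       = λ a → col-unique (from (pres-1' a a) refl)
    ; col-sym        = λ a b → sym (col-unique (from (pres-conv ⁅ col a b ⁆ b a) (col-atom a b)))
    ; col-consistent = λ a b c → atoms-consistent {col a c} {col c b} {col a b}
                                   (col-atom a c) (col-atom c b) (col-atom a b)
    }

  isosceles-realised : ∀ {γ δ} → NonDegenerate γ δ →
                       ¬ ¬ (∃ λ a → ∃ λ b → ∃ λ c → col a b ≡ γ × col b c ≡ γ × col a c ≡ δ)
  isosceles-realised {zero} (γ≢0 , _) = ⊥-elim (γ≢0 refl)
  isosceles-realised {suc _} {zero} (_ , δ≢0 , _) = ⊥-elim (δ≢0 refl)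
  isosceles-realised {suc γ} {suc δ} (_ , _ , γ≢δ) κ =
    atoms-realised {suc γ} {suc γ} {suc δ} (consistent-isosceles (γ≢δ ∘ cong suc))
      λ (a , b , c , ac , cb , ab) →
      κ (a , c , b , col-unique ac , col-unique cb , col-unique ab)

¬¬-collect : ∀ {A : Set} {m} {Q : Fin m → List A → Set} →
             (∀ i {L M} → L ⊆ₗ M → Q i L → Q i M) →
             (∀ i → ¬ ¬ ∃ (Q i)) → ¬ ¬ ∃ λ L → ∀ i → Q i L
¬¬-collect {m = zero} _ _ κ = κ ([] , λ ())
¬¬-collect {m = suc m} mono exists κ =
  exists zero λ (L₀ , q₀) →
  ¬¬-collect (λ i → mono (suc i)) (λ i → exists (suc i)) λ (L , q) →
  κ (L₀ ++ L , λ where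
       zero    → mono zero (xs⊆xs++ys L₀ L) q₀
       (suc i) → mono (suc i) (xs⊆ys++xs L L₀) (q i))

module _ {m : ℕ} {U : Set} (R : QualRep (suc (suc (suc m))) U) where
  open Representation R using (colouring; isosceles-realised)
  open Gallai colouring

  isosceles-in-list : ∀ (γ δ : Colour) → ¬ ¬ ∃ λ L → NonDegenerate γ δ → Isosceles L γ δ
  isosceles-in-list γ δ κ with nonDegenerate? γ δ
  ... | no ¬nd = κ ([] , ⊥-elim ∘ ¬nd)
  ... | yes nd = isosceles-realised nd λ (a , b , c , ab , bc , ac) →
    κ (a ∷ b ∷ c ∷ [] ,
       λ _ → isosceles a b c (here refl) (there (here refl)) (there (there (here refl))) ab bc ac)

  isosceles-complete-list : ¬ ¬ ∃ IsoscelesComplete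
  isosceles-complete-list =
    ¬¬-collect (λ _ L⊆M iso δ nd → Isosceles-mono L⊆M (iso δ nd)) λ γ →
    ¬¬-collect (λ _ L⊆M iso nd → Isosceles-mono L⊆M (iso nd)) (isosceles-in-list γ)

  c₁ c₂ c₃ : Colour
  c₁ = suc zero
  c₂ = suc (suc zero)
  c₃ = suc (suc (suc zero))

  pigeonhole : ∀ {α β} → c₁ ≡ α ⊎ c₁ ≡ β → c₂ ≡ α ⊎ c₂ ≡ β → c₃ ≡ α ⊎ c₃ ≡ β → ⊥
  pigeonhole (inj₁ refl) (inj₁ ())     _
  pigeonhole (inj₁ refl) (inj₂ refl) (inj₁ ())
  pigeonhole (inj₁ refl) (inj₂ refl) (inj₂ ())
  pigeonhole (inj₂ refl) (inj₂ ())     _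
  pigeonhole (inj₂ refl) (inj₁ refl) (inj₁ ())
  pigeonhole (inj₂ refl) (inj₁ refl) (inj₂ ())

  third-colour : ∀ α β → ∃ (Avoids α β)
  third-colour α β with avoids? α β c₁ | avoids? α β c₂ | avoids? α β c₃
  ... | yes av | _ | _ = c₁ , av
  ... | no _ | yes av | _ = c₂ , av
  ... | no _ | no _ | yes av = c₃ , av
  ... | no ¬av₁ | no ¬av₂ | no ¬av₃ =
    ⊥-elim (pigeonhole (¬Avoids⇒≡ (λ ()) ¬av₁) (¬Avoids⇒≡ (λ ()) ¬av₂) (¬Avoids⇒≡ (λ ()) ¬av₃))

  ¬representation : ⊥
  ¬representation = isosceles-complete-list λ (L , iso) →
    gallai L (Isosceles⇒HasDistinct (λ ()) (iso c₁ c₂ ((λ ()) , (λ ()) , (λ ())))) λ D →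
    IsoscelesComplete⇒¬Disconnection iso third-colour D

theorem25 : (n : ℕ) → 2 < n → ¬ QualitativelyRepresentable n
theorem25 _ (s≤s (s≤s (s≤s _))) (_ , R) = ¬representation R
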